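{- There is an absolute constant $C$ such that for all $n$ and $W$, $$\mathrm{vfg}(n,W)\le C\cdot\max\{\mathrm{vufg}(n',W') : n'\le Cn^2,\ W'\le CW\}.$$
   Context: For a directed graph $G=(V,E)$ with nonnegative vertex weights $w$, $\mathrm{vdist}_w(s,t)$ is the minimum over $s\leadsto t$ paths $\pi$ of the total weight of the interior vertices of $\pi$. A set $X\subseteq V$ is an integral vertex cut for the pairs at vertex-weighted distance $\ge1$ if for every $(s,t)$ with $\mathrm{vdist}_w(s,t)\ge1$, every $s\leadsto t$ path contains an internal node (other than $s,t$) in $X$. $\mathrm{vfg}(n,W)$ is the least integer such that for every $n$-node directed graph with nonnegative vertex costs $\mathrm{cost}$ and nonnegative vertex weights $w$ with $w(V)=W$, there is such a cut $X$ with $\mathrm{cost}(X)\le\langle\mathrm{cost},w\rangle\cdot\mathrm{vfg}(n,W)$, where $\mathrm{cost}(X)=\sum_{v\in X}\mathrm{cost}(v)$ and $\langle\mathrm{cost},w\rangle=\sum_v\mathrm{cost}(v)w(v)$. $\mathrm{vufg}(n,W)$ is defined the same way but only over instances in which every vertex has cost $1$.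
   Formalization: The vertex costs and weights, and with them $W$ and $W'$, are nonnegative rationals, also in the instances over which $\mathrm{vfg}$ and $\mathrm{vufg}$ are defined. -}

module Defs where

open import Data.Nat as ℕ using (ℕ; zero; suc)
open import Data.Integer using (+_)
open import Data.Rational using (ℚ; 0ℚ; 1ℚ; _+_; _*_; _≤_; _/_)
open import Data.Fin using (Fin; zero; suc)
open import Data.Bool using (Bool; T)
open import Data.List using (List; []; _∷_; map)
open import Data.List.Membership.Propositional using (_∈_)
open import Data.Product using (Σ; _×_; ∃; ∃-syntax)
open import Relation.Binary.PropositionalEquality using (_≡_; _≢_)

ℕtoℚ : ℕ → ℚ
ℕtoℚ k = (+ k) / 1

Σℚ : ∀ {n} → (Fin n → ℚ) → ℚ
Σℚ {zero}  f = 0ℚ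
Σℚ {suc n} f = f zero + Σℚ (λ i → f (suc i))

sumList : List ℚ → ℚ
sumList []       = 0ℚ
sumList (x ∷ xs) = x + sumList xs

Graph : ℕ → Set
Graph n = Fin n → Fin n → Bool

data Walk {n : ℕ} (E : Graph n) : Fin n → Fin n → Set where
  done : ∀ {s} → Walk E s s
  step : ∀ {s u t} → T (E s u) → Walk E u t → Walk E s t

interior : ∀ {n} {E : Graph n} {s t} → Walk E s t → List (Fin n)
interior done                        = []
interior (step e done)               = []
interior (step {u = u} e (step e' p)) = u ∷ interior (step e' p)

interiorWeight : ∀ {n} {E : Graph n} → (Fin n → ℚ) → ∀ {s t} → Walk E s t → ℚ
interiorWeight w p = sumList (map w (interior p))

VdistGe1 : ∀ {n} → Graph n → (Fin n → ℚ) → Fin n → Fin n → Set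
VdistGe1 E w s t = ∀ (p : Walk E s t) → 1ℚ ≤ interiorWeight w p

IsCut : ∀ {n} → Graph n → (Fin n → ℚ) → (Fin n → Bool) → Set
IsCut E w X = ∀ s t → VdistGe1 E w s t → ∀ (p : Walk E s t) →
  ∃[ v ] (v ∈ interior p × v ≢ s × v ≢ t × T (X v))

NonNeg : ∀ {n} → (Fin n → ℚ) → Set
NonNeg f = ∀ v → 0ℚ ≤ f v

costOf : ∀ {n} → (Fin n → ℚ) → (Fin n → Bool) → ℚ
costOf cost X = Σℚ (λ v → if X v then cost v else 0ℚ)
  where open import Data.Bool using (if_then_else_)

inner : ∀ {n} → (Fin n → ℚ) → (Fin n → ℚ) → ℚ
inner cost w = Σℚ (λ v → cost v * w v)

Good : ℕ → ℚ → ℕ → Set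
Good n W k = ∀ (E : Graph n) (cost w : Fin n → ℚ) → NonNeg cost → NonNeg w →
  Σℚ w ≡ W → ∃[ X ] (IsCut E w X × costOf cost X ≤ inner cost w * ℕtoℚ k)

GoodU : ℕ → ℚ → ℕ → Set
GoodU n W k = ∀ (E : Graph n) (w : Fin n → ℚ) → NonNeg w →
  Σℚ w ≡ W → ∃[ X ] (IsCut E w X × costOf (λ _ → 1ℚ) X ≤ inner (λ _ → 1ℚ) w * ℕtoℚ k)

IsVfg : ℕ → ℚ → ℕ → Set
IsVfg n W k = Good n W k × (∀ j → Good n W j → k ℕ.≤ j)

IsVufg : ℕ → ℚ → ℕ → Set
IsVufg n W k = GoodU n W k × (∀ j → GoodU n W j → k ℕ.≤ j)

-- Let Λ = ⟨cost, w⟩. Call a vertex heavy when 2n·w(v) > 1 and round the weights to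
-- min(1, 2w(v)) on heavy vertices and 0 on the others. A simple path has at most n vertices, so its
-- light vertices carry weight at most 1/2 and distance ≥ 1 survives the rounding; the rounded total
-- W₂ is at most min(n, 2W). With N = ⌈W₂⌉, replace each heavy vertex v by K(v) = ⌈N·cost(v)/Λ⌉
-- unit-cost copies (each light vertex by one copy) and join two copies when their originals are joined
-- by a walk through light vertices. Distances ≥ 1 survive, and a unit-cost cut X′ of this blow-up gives
-- the cut of all heavy vertices whose copies all lie in X′, of cost at most (Λ/N)|X′|. The blow-up has
-- at most n(2N+1) ≤ 8n² vertices and weight at most 2N + W₂ ≤ 8W, so a cut of size ≤ M times its
-- weight costs at most 3ΛM. The cases W < 1 (empty cut) and Λ = 0 (threshold cut) are direct.

module Submission where

open import Defs

module CostReduction where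

  open import Data.Nat as ℕ using (ℕ; zero; suc)
  import Data.Nat.Properties as ℕP
  import Data.Nat.Solver
  import Data.Nat.Coprimality as Coprimality
  import Data.Integer as ℤ
  import Data.Integer.Properties as ℤP
  open import Data.Rational as ℚ using (ℚ; 0ℚ; 1ℚ; _+_; _*_; _≤_; _<_; _⊓_; mkℚ; *≤*; *<*)
  import Data.Rational.Properties as QP
  open import Data.Rational.Solver using (module +-*-Solver)
  open import Data.Fin as Fin using (Fin; zero; suc; _↑ˡ_; _↑ʳ_; splitAt)
  import Data.Fin.Properties as FinP
  open import Data.Fin.Subset.Properties using (anySubset?)
  open import Data.Vec using (lookup; tabulate)
  open import Data.Vec.Properties using (lookup∘tabulate)
  open import Data.Bool using (Bool; true; false; T; if_then_else_)
  open import Data.Bool.Properties using (T-irrelevant)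
  open import Data.Empty using (⊥-elim)
  open import Data.Product using (∃; Σ-syntax; ∃-syntax; _×_; _,_; proj₁; proj₂)
  open import Data.Sum as Sum using (inj₁; inj₂)
  open import Data.List using (List; []; _∷_; _++_; [_]; map; concatMap; allFin; length)
  open import Data.List.Membership.Propositional using (_∈_; find; lose)
  open import Data.List.Membership.Propositional.Properties using (∈-map⁺; ∈-++⁺ˡ; ∈-++⁺ʳ; ∈-++⁻; ∈-concatMap⁺; ∈-allFin)
  import Data.List.Membership.DecPropositional as DecMembership
  open import Data.List.Relation.Unary.Any as Any using (Any; here; there)
  open import Data.List.Relation.Unary.All as All using (All; []; _∷_)
  import Data.List.Relation.Unary.All.Properties as AllP
  open import Data.List.Relation.Unary.AllPairs using ([]; _∷_)
  open import Data.List.Relation.Unary.Unique.Propositional using (Unique)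
  open import Data.List.Relation.Binary.Sublist.Propositional as Sublist using (_⊆_; []; _∷_; _∷ʳ_; ⊆-refl; ⊆-trans)
  open import Relation.Nullary using (¬_; Dec; yes; no)
  open import Relation.Nullary.Negation using (¬¬-map)
  open import Relation.Nullary.Decidable as Dec using (isYes; T?; ¬?; _×-dec_; _→-dec_; toWitness; fromWitness; decidable-stable)
  open import Relation.Unary using (Decidable)
  open import Relation.Binary.PropositionalEquality using (_≡_; _≢_; refl; sym; trans; cong; cong₂; subst; subst₂; module ≡-Reasoning)
  open +-*-Solver

  private
    ℕtoℚ≡mkℚ : ∀ k → ℕtoℚ k ≡ mkℚ (ℤ.+ k) 0 (Coprimality.sym (Coprimality.1-coprimeTo k))
    ℕtoℚ≡mkℚ k = QP.↥p/↧p≡p _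

  ℕtoℚ-+ : ∀ a b → ℕtoℚ (a ℕ.+ b) ≡ ℕtoℚ a + ℕtoℚ b
  ℕtoℚ-+ a b rewrite ℕtoℚ≡mkℚ a | ℕtoℚ≡mkℚ b =
    QP./-cong {ℤ.+ (a ℕ.+ b)} {1} {ℤ.+ a ℤ.* ℤ.+ 1 ℤ.+ ℤ.+ b ℤ.* ℤ.+ 1} {1}
      (cong₂ ℤ._+_ (sym (ℤP.*-identityʳ (ℤ.+ a))) (sym (ℤP.*-identityʳ (ℤ.+ b)))) refl

  ℕtoℚ-* : ∀ a b → ℕtoℚ (a ℕ.* b) ≡ ℕtoℚ a * ℕtoℚ b
  ℕtoℚ-* a b rewrite ℕtoℚ≡mkℚ a | ℕtoℚ≡mkℚ b =
    QP./-cong {ℤ.+ (a ℕ.* b)} {1} {ℤ.+ a ℤ.* ℤ.+ b} {1} (sym (ℤP.+◃n≡+n (a ℕ.* b))) refl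

  ℕtoℚ-mono-≤ : ∀ {a b} → a ℕ.≤ b → ℕtoℚ a ≤ ℕtoℚ b
  ℕtoℚ-mono-≤ {a} {b} a≤b rewrite ℕtoℚ≡mkℚ a | ℕtoℚ≡mkℚ b =
    *≤* (ℤP.*-monoʳ-≤-nonNeg (ℤ.+ 1) (ℤ.+≤+ a≤b))

  ℕtoℚ-cancel-≤ : ∀ {a b} → ℕtoℚ a ≤ ℕtoℚ b → a ℕ.≤ b
  ℕtoℚ-cancel-≤ {a} {b} le rewrite ℕtoℚ≡mkℚ a | ℕtoℚ≡mkℚ b with le
  ... | *≤* p = ℤ.drop‿+≤+ (subst₂ ℤ._≤_ (ℤP.*-identityʳ (ℤ.+ a)) (ℤP.*-identityʳ (ℤ.+ b)) p)

  ℕtoℚ-nonNeg : ∀ a → 0ℚ ≤ ℕtoℚ a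
  ℕtoℚ-nonNeg a = ℕtoℚ-mono-≤ {0} {a} ℕ.z≤n

  0<1 : 0ℚ < 1ℚ
  0<1 = *<* (ℤ.+<+ (ℕ.s≤s ℕ.z≤n))

  1≰0 : ¬ (1ℚ ≤ 0ℚ)
  1≰0 1≤0 = QP.<-irrefl refl (QP.<-≤-trans 0<1 1≤0)

  ℕtoℚ-suc-pos : ∀ k → 0ℚ < ℕtoℚ (suc k)
  ℕtoℚ-suc-pos k = QP.<-≤-trans 0<1 (ℕtoℚ-mono-≤ {1} {suc k} (ℕ.s≤s ℕ.z≤n))

  *-monoˡ-≤ : ∀ {r p q} → 0ℚ ≤ r → p ≤ q → r * p ≤ r * q
  *-monoˡ-≤ {r} 0≤r = QP.*-monoˡ-≤-nonNeg r {{ℚ.nonNegative 0≤r}}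

  *-monoʳ-≤ : ∀ {r p q} → 0ℚ ≤ r → p ≤ q → p * r ≤ q * r
  *-monoʳ-≤ {r} 0≤r = QP.*-monoʳ-≤-nonNeg r {{ℚ.nonNegative 0≤r}}

  *-cancelˡ-≤ : ∀ {r p q} → 0ℚ < r → r * p ≤ r * q → p ≤ q
  *-cancelˡ-≤ {r} 0<r = QP.*-cancelˡ-≤-pos r {{ℚ.positive 0<r}}

  *-nonNeg : ∀ {p q} → 0ℚ ≤ p → 0ℚ ≤ q → 0ℚ ≤ p * q
  *-nonNeg {p} {q} 0≤p 0≤q = subst (_≤ p * q) (QP.*-zeroˡ q) (*-monoʳ-≤ 0≤q 0≤p)

  +-nonNeg : ∀ {p q} → 0ℚ ≤ p → 0ℚ ≤ q → 0ℚ ≤ p + q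
  +-nonNeg = QP.+-mono-≤

  +-cancelʳ-≤ : ∀ {p q} r → p + r ≤ q + r → p ≤ q
  +-cancelʳ-≤ {p} {q} r le = subst₂ _≤_ (cancel p) (cancel q) (QP.+-monoˡ-≤ (ℚ.- r) le)
    where
    cancel : ∀ x → x + r + ℚ.- r ≡ x
    cancel x = solve 2 (λ x r → x :+ r :+ :- r := x) refl x r

  Σℚ-cong : ∀ {n} {f g : Fin n → ℚ} → (∀ i → f i ≡ g i) → Σℚ f ≡ Σℚ g
  Σℚ-cong {zero}  f≗g = refl
  Σℚ-cong {suc n} f≗g = cong₂ _+_ (f≗g zero) (Σℚ-cong (λ i → f≗g (suc i)))


  Σℚ-mono-≤ : ∀ {n} {f g : Fin n → ℚ} → (∀ i → f i ≤ g i) → Σℚ f ≤ Σℚ g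
  Σℚ-mono-≤ {zero}  f≤g = QP.≤-refl
  Σℚ-mono-≤ {suc n} f≤g = QP.+-mono-≤ (f≤g zero) (Σℚ-mono-≤ (λ i → f≤g (suc i)))

  Σℚ-nonNeg : ∀ {n} {f : Fin n → ℚ} → NonNeg f → 0ℚ ≤ Σℚ f
  Σℚ-nonNeg {zero}  f≥0 = QP.≤-refl
  Σℚ-nonNeg {suc n} f≥0 = +-nonNeg (f≥0 zero) (Σℚ-nonNeg (λ i → f≥0 (suc i)))

  Σℚ-+ : ∀ {n} (f g : Fin n → ℚ) → Σℚ (λ i → f i + g i) ≡ Σℚ f + Σℚ g
  Σℚ-+ {zero}  f g = refl
  Σℚ-+ {suc n} f g rewrite Σℚ-+ (λ i → f (suc i)) (λ i → g (suc i)) =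
    solve 4 (λ a b c d → (a :+ b) :+ (c :+ d) := (a :+ c) :+ (b :+ d)) refl
      (f zero) (g zero) (Σℚ (λ i → f (suc i))) (Σℚ (λ i → g (suc i)))

  Σℚ-*ˡ : ∀ {n} a (f : Fin n → ℚ) → Σℚ (λ i → a * f i) ≡ a * Σℚ f
  Σℚ-*ˡ {zero}  a f = sym (QP.*-zeroʳ a)
  Σℚ-*ˡ {suc n} a f rewrite Σℚ-*ˡ a (λ i → f (suc i)) =
    sym (QP.*-distribˡ-+ a (f zero) (Σℚ (λ i → f (suc i))))

  Σℚ-const : ∀ {n} a → Σℚ {n} (λ _ → a) ≡ ℕtoℚ n * a
  Σℚ-const {zero}  a = sym (QP.*-zeroˡ a)
  Σℚ-const {suc n} a rewrite Σℚ-const {n} a | ℕtoℚ-+ 1 n =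
    solve 2 (λ a m → a :+ m :* a := (con 1ℚ :+ m) :* a) refl a (ℕtoℚ n)

  term≤Σℚ : ∀ {n} {f : Fin n → ℚ} → NonNeg f → ∀ i → f i ≤ Σℚ f
  term≤Σℚ {suc n} {f} f≥0 zero =
    subst (_≤ Σℚ f) (QP.+-identityʳ (f zero)) (QP.+-monoʳ-≤ (f zero) (Σℚ-nonNeg (λ i → f≥0 (suc i))))
  term≤Σℚ {suc n} {f} f≥0 (suc i) =
    subst (_≤ Σℚ f) (QP.+-identityˡ (f (suc i))) (QP.+-mono-≤ (f≥0 zero) (term≤Σℚ (λ i → f≥0 (suc i)) i))

  vanishAt : ∀ {n} → Fin n → (Fin n → ℚ) → Fin n → ℚ
  vanishAt x f v = if isYes (v Fin.≟ x) then 0ℚ else f v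

  vanishAt-nonNeg : ∀ {n} x {f : Fin n → ℚ} → NonNeg f → NonNeg (vanishAt x f)
  vanishAt-nonNeg x f≥0 v with v Fin.≟ x
  ... | yes _ = QP.≤-refl
  ... | no  _ = f≥0 v

  vanishAt-≢ : ∀ {n} {x v} (f : Fin n → ℚ) → v ≢ x → vanishAt x f v ≡ f v
  vanishAt-≢ {x = x} {v} f v≢x with v Fin.≟ x
  ... | yes v≡x = ⊥-elim (v≢x v≡x)
  ... | no  _   = refl

  Σℚ-vanishAt : ∀ {n} x (f : Fin n → ℚ) → Σℚ f ≡ f x + Σℚ (vanishAt x f)
  Σℚ-vanishAt {suc n} zero f =
    cong (f zero +_) (trans (Σℚ-cong (λ i → sym (vanishAt-≢ {x = zero} {suc i} f λ ()))) (sym (QP.+-identityˡ _)))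
  Σℚ-vanishAt {suc n} (suc x) f = begin
    f zero + Σℚ (λ i → f (suc i))
      ≡⟨ cong (f zero +_) (Σℚ-vanishAt x (λ i → f (suc i))) ⟩
    f zero + (f (suc x) + Σℚ (vanishAt x (λ i → f (suc i))))
      ≡⟨ solve 3 (λ a b c → a :+ (b :+ c) := b :+ (a :+ c)) refl (f zero) (f (suc x)) _ ⟩
    f (suc x) + (f zero + Σℚ (vanishAt x (λ i → f (suc i))))
      ≡⟨ cong (λ z → f (suc x) + (f zero + z)) (Σℚ-cong vanishAt-suc) ⟩
    f (suc x) + Σℚ (vanishAt (suc x) f) ∎
    where
    open ≡-Reasoning
    vanishAt-suc : ∀ i → vanishAt x (λ i → f (suc i)) i ≡ vanishAt (suc x) f (suc i)
    vanishAt-suc i with i Fin.≟ x | suc i Fin.≟ suc x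
    ... | yes _   | yes _     = refl
    ... | no  _   | no  _     = refl
    ... | yes i≡x | no  si≢sx = ⊥-elim (si≢sx (cong suc i≡x))
    ... | no  i≢x | yes si≡sx = ⊥-elim (i≢x (FinP.suc-injective si≡sx))

  sumOver : ∀ {A : Set} → (A → ℚ) → List A → ℚ
  sumOver w xs = sumList (map w xs)

  module _ {A : Set} where

    sumOver-++ : ∀ (w : A → ℚ) xs ys → sumOver w (xs ++ ys) ≡ sumOver w xs + sumOver w ys
    sumOver-++ w []       ys = sym (QP.+-identityˡ _)
    sumOver-++ w (x ∷ xs) ys rewrite sumOver-++ w xs ys = sym (QP.+-assoc (w x) (sumOver w xs) (sumOver w ys))

    sumOver-nonNeg : ∀ {w : A → ℚ} → (∀ x → 0ℚ ≤ w x) → ∀ xs → 0ℚ ≤ sumOver w xs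
    sumOver-nonNeg w≥0 []       = QP.≤-refl
    sumOver-nonNeg w≥0 (x ∷ xs) = +-nonNeg (w≥0 x) (sumOver-nonNeg w≥0 xs)

    sumOver-mono-≤ : ∀ {f g : A → ℚ} xs → (∀ {x} → x ∈ xs → f x ≤ g x) → sumOver f xs ≤ sumOver g xs
    sumOver-mono-≤ []       f≤g = QP.≤-refl
    sumOver-mono-≤ (x ∷ xs) f≤g = QP.+-mono-≤ (f≤g (here refl)) (sumOver-mono-≤ xs (λ m → f≤g (there m)))

    sumOver-+ : ∀ (f g : A → ℚ) xs → sumOver (λ x → f x + g x) xs ≡ sumOver f xs + sumOver g xs
    sumOver-+ f g []       = refl
    sumOver-+ f g (x ∷ xs) rewrite sumOver-+ f g xs =
      solve 4 (λ a b c d → (a :+ b) :+ (c :+ d) := (a :+ c) :+ (b :+ d)) refl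
        (f x) (g x) (sumOver f xs) (sumOver g xs)

    sumOver-*ˡ : ∀ a (f : A → ℚ) xs → sumOver (λ x → a * f x) xs ≡ a * sumOver f xs
    sumOver-*ˡ a f []       = sym (QP.*-zeroʳ a)
    sumOver-*ˡ a f (x ∷ xs) rewrite sumOver-*ˡ a f xs = sym (QP.*-distribˡ-+ a (f x) (sumOver f xs))

    sumOver-1 : ∀ (xs : List A) → sumOver (λ _ → 1ℚ) xs ≡ ℕtoℚ (length xs)
    sumOver-1 []       = refl
    sumOver-1 (x ∷ xs) = trans (cong (1ℚ +_) (sumOver-1 xs)) (sym (ℕtoℚ-+ 1 (length xs)))

    sumOver-zero : ∀ {w : A → ℚ} {xs} → All (λ x → w x ≡ 0ℚ) xs → sumOver w xs ≡ 0ℚ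
    sumOver-zero []           = refl
    sumOver-zero {w} {x ∷ xs} (wx≡0 ∷ all) rewrite wx≡0 | sumOver-zero {w} {xs} all = QP.+-identityˡ 0ℚ

    ∈⇒≤sumOver : ∀ {w : A → ℚ} → (∀ x → 0ℚ ≤ w x) → ∀ {x xs} → x ∈ xs → w x ≤ sumOver w xs
    ∈⇒≤sumOver {w} w≥0 {x} {x ∷ xs} (here refl) =
      subst (_≤ sumOver w (x ∷ xs)) (QP.+-identityʳ (w x)) (QP.+-monoʳ-≤ (w x) (sumOver-nonNeg w≥0 xs))
    ∈⇒≤sumOver {w} w≥0 {x} {y ∷ xs} (there m) =
      subst (_≤ sumOver w (y ∷ xs)) (QP.+-identityˡ (w x)) (QP.+-mono-≤ (w≥0 y) (∈⇒≤sumOver w≥0 m))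

    sumOver-⊆ : ∀ {w : A → ℚ} → (∀ x → 0ℚ ≤ w x) → ∀ {xs ys} → xs ⊆ ys → sumOver w xs ≤ sumOver w ys
    sumOver-⊆ w≥0 []               = QP.≤-refl
    sumOver-⊆ {w} w≥0 (_∷_ {x = x} refl xs⊆ys) = QP.+-monoʳ-≤ (w x) (sumOver-⊆ w≥0 xs⊆ys)
    sumOver-⊆ {w} w≥0 {xs} (y ∷ʳ xs⊆ys) =
      subst (_≤ w y + _) (QP.+-identityˡ (sumOver w xs)) (QP.+-mono-≤ (w≥0 y) (sumOver-⊆ w≥0 xs⊆ys))

  sumOver-unique-≤ : ∀ {n} {w : Fin n → ℚ} → NonNeg w → ∀ {xs} → Unique xs → sumOver w xs ≤ Σℚ w
  sumOver-unique-≤ w≥0 {[]}     []               = Σℚ-nonNeg w≥0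
  sumOver-unique-≤ {w = w} w≥0 {x ∷ xs} (x≢xs ∷ uniq) =
    subst₂ _≤_ (cong (w x +_) (sumOver-vanish xs x≢xs)) (sym (Σℚ-vanishAt x w))
      (QP.+-monoʳ-≤ (w x) (sumOver-unique-≤ (vanishAt-nonNeg x w≥0) uniq))
    where
    sumOver-vanish : ∀ ys → All (x ≢_) ys → sumOver (vanishAt x w) ys ≡ sumOver w ys
    sumOver-vanish []       []            = refl
    sumOver-vanish (y ∷ ys) (x≢y ∷ x≢ys) =
      cong₂ _+_ (vanishAt-≢ w (λ y≡x → x≢y (sym y≡x))) (sumOver-vanish ys x≢ys)

  unique-length-≤ : ∀ {n} {xs : List (Fin n)} → Unique xs → length xs ℕ.≤ n
  unique-length-≤ {n} {xs} uniq = ℕtoℚ-cancel-≤ (begin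
    ℕtoℚ (length xs)      ≡⟨ sym (sumOver-1 xs) ⟩
    sumOver (λ _ → 1ℚ) xs ≤⟨ sumOver-unique-≤ {w = λ _ → 1ℚ} (λ _ → QP.<⇒≤ 0<1) uniq ⟩
    Σℚ {n} (λ _ → 1ℚ)     ≡⟨ trans (Σℚ-const {n} 1ℚ) (QP.*-identityʳ (ℕtoℚ n)) ⟩
    ℕtoℚ n                ∎)
    where open QP.≤-Reasoning

  -- Walks and simple walks

  module _ {n : ℕ} {E : Graph n} where

    open DecMembership (Fin._≟_ {n}) using (_∈?_)

    len : ∀ {s t} → Walk E s t → ℕ
    len done       = 0
    len (step _ p) = suc (len p)

    tailVertices : ∀ {s t} → Walk E s t → List (Fin n)
    tailVertices done               = []
    tailVertices (step {u = u} _ p) = u ∷ tailVertices p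

    _++ʷ_ : ∀ {s u t} → Walk E s u → Walk E u t → Walk E s t
    done     ++ʷ q = q
    step e p ++ʷ q = step e (p ++ʷ q)

    _▹_ : ∀ {s u t} → Walk E s u → T (E u t) → Walk E s t
    done     ▹ e = step e done
    step e p ▹ e′ = step e (p ▹ e′)

    length-tailVertices : ∀ {s t} (p : Walk E s t) → length (tailVertices p) ≡ len p
    length-tailVertices done       = refl
    length-tailVertices (step e p) = cong suc (length-tailVertices p)

    length-interior-≤ : ∀ {s t} (p : Walk E s t) → length (interior p) ℕ.≤ len p
    length-interior-≤ done                = ℕ.z≤n
    length-interior-≤ (step e done)       = ℕ.z≤n
    length-interior-≤ (step e (step e′ p)) = ℕ.s≤s (length-interior-≤ (step e′ p))

    tailVertices-++ʷ : ∀ {s u t} (p : Walk E s u) (q : Walk E u t) →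
      tailVertices (p ++ʷ q) ≡ tailVertices p ++ tailVertices q
    tailVertices-++ʷ done       q = refl
    tailVertices-++ʷ (step e p) q = cong (_ ∷_) (tailVertices-++ʷ p q)

    interior-▹ : ∀ {s u t} (p : Walk E s u) (e : T (E u t)) → interior (p ▹ e) ≡ tailVertices p
    interior-▹ done                 e = refl
    interior-▹ (step e′ done)        e = refl
    interior-▹ (step e′ (step e″ p)) e = cong (_ ∷_) (interior-▹ (step e″ p) e)

    len-▹ : ∀ {s u t} (p : Walk E s u) (e : T (E u t)) → len (p ▹ e) ≡ suc (len p)
    len-▹ done       e = refl
    len-▹ (step e′ p) e = cong suc (len-▹ p e)

    tailVertices-▹ : ∀ {s u t} (p : Walk E s u) (e : T (E u t)) → tailVertices (p ▹ e) ≡ tailVertices p ++ [ t ]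
    tailVertices-▹ done       e = refl
    tailVertices-▹ (step e′ p) e = cong (_ ∷_) (tailVertices-▹ p e)

    interior-∷ʳ : ∀ {s t} (p : Walk E s t) → 1 ℕ.≤ len p → interior p ++ [ t ] ≡ tailVertices p
    interior-∷ʳ (step e done)       _ = refl
    interior-∷ʳ (step e (step e′ p)) _ = cong (_ ∷_) (interior-∷ʳ (step e′ p) (ℕ.s≤s ℕ.z≤n))

    interiorWeight-+ : ∀ (w : Fin n → ℚ) {s t} (p : Walk E s t) → 1 ℕ.≤ len p →
      interiorWeight w p + w t ≡ sumOver w (tailVertices p)
    interiorWeight-+ w {t = t} p 1≤len = begin
      sumOver w (interior p) + w t              ≡⟨ cong (sumOver w (interior p) +_) (sym (QP.+-identityʳ (w t))) ⟩
      sumOver w (interior p) + sumOver w [ t ]  ≡⟨ sym (sumOver-++ w (interior p) [ t ]) ⟩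
      sumOver w (interior p ++ [ t ])           ≡⟨ cong (sumOver w) (interior-∷ʳ p 1≤len) ⟩
      sumOver w (tailVertices p)                ∎
      where open ≡-Reasoning

    ≢⇒1≤len : ∀ {s t} → s ≢ t → (p : Walk E s t) → 1 ℕ.≤ len p
    ≢⇒1≤len s≢t done       = ⊥-elim (s≢t refl)
    ≢⇒1≤len s≢t (step e p) = ℕ.s≤s ℕ.z≤n

    interior⊆tailVertices : ∀ {s t} (p : Walk E s t) → interior p ⊆ tailVertices p
    interior⊆tailVertices done                = []
    interior⊆tailVertices (step e done)       = _ ∷ʳ []
    interior⊆tailVertices (step e (step e′ p)) = refl ∷ interior⊆tailVertices (step e′ p)

    target∈tailVertices : ∀ {s t} (p : Walk E s t) → 1 ℕ.≤ len p → t ∈ tailVertices p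
    target∈tailVertices p 1≤len = subst (_ ∈_) (interior-∷ʳ p 1≤len) (∈-++⁺ʳ (interior p) (here refl))

    All-interior-step : ∀ {P : Fin n → Set} {s u t} (e : T (E s u)) (p : Walk E u t) →
      P u → All P (interior p) → All P (interior (step e p))
    All-interior-step e done        Pu _   = []
    All-interior-step e (step e′ p) Pu all = Pu ∷ all

    Simple : ∀ {s t} → Walk E s t → Set
    Simple {s} p = Unique (s ∷ tailVertices p)

    private
      dropTo : ∀ {u t} (r : Walk E u t) {s} → s ∈ u ∷ tailVertices r → Simple r →
        Σ[ r′ ∈ Walk E s t ] (Simple r′ × tailVertices r′ ⊆ tailVertices r)
      dropTo r          (here refl) simple       = r , simple , ⊆-refl
      dropTo (step e r) (there m)   (_ ∷ simple) with dropTo r m simple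
      ... | r′ , simple′ , r′⊆r = r′ , simple′ , (_ ∷ʳ r′⊆r)

    removeCycles : ∀ {s t} (p : Walk E s t) → Σ[ q ∈ Walk E s t ] (Simple q × tailVertices q ⊆ tailVertices p)
    removeCycles done = done , [] ∷ [] , []
    removeCycles {s} (step {u = u} e p) with removeCycles p
    ... | q , simple , q⊆p with s ∈? u ∷ tailVertices q
    ...   | yes s∈ = let r , simple′ , r⊆q = dropTo q s∈ simple in r , simple′ , (u ∷ʳ ⊆-trans r⊆q q⊆p)
    ...   | no  s∉ = step e q , AllP.¬Any⇒All¬ _ s∉ ∷ simple , refl ∷ q⊆p

    simple-len : ∀ {s t} {q : Walk E s t} → Simple q → suc (len q) ℕ.≤ n
    simple-len {q = q} simple = subst (ℕ._≤ n) (cong suc (length-tailVertices q)) (unique-length-≤ simple)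

    simple-interior : ∀ {s t} (q : Walk E s t) → Simple q → ∀ {v} → v ∈ interior q → v ≢ s × v ≢ t
    simple-interior (step e (step e′ q)) ((s≢u ∷ _) ∷ u≢rest ∷ _) (here refl) =
      (λ u≡s → s≢u (sym u≡s)) , All.lookup u≢rest (target∈tailVertices (step e′ q) (ℕ.s≤s ℕ.z≤n))
    simple-interior (step e (step e′ q)) ((_ ∷ s≢rest) ∷ simple) (there v∈) =
      (λ v≡s → All.lookup s≢rest (Sublist.lookup (interior⊆tailVertices (step e′ q)) v∈) (sym v≡s)) ,
      proj₂ (simple-interior (step e′ q) simple v∈)

    simple-interiorWeight-≤ : ∀ {w : Fin n → ℚ} → NonNeg w → ∀ {s t} {q : Walk E s t} → Simple q →
      interiorWeight w q ≤ Σℚ w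
    simple-interiorWeight-≤ w≥0 {q = q} (_ ∷ tail-unique) =
      QP.≤-trans (sumOver-⊆ w≥0 (interior⊆tailVertices q)) (sumOver-unique-≤ w≥0 tail-unique)

    record Shortening {s t} (p : Walk E s t) : Set where
      field
        walk      : Walk E s t
        simple    : Simple walk
        interior⊆ : ∀ {v} → v ∈ interior walk → v ∈ interior p
        weight-≤  : ∀ {w} → NonNeg w → interiorWeight w walk ≤ interiorWeight w p

    shortening : ∀ {s t} → s ≢ t → (p : Walk E s t) → Shortening p
    shortening {t = t} s≢t p with removeCycles p
    ... | q , simple , q⊆p = record
      { walk      = q
      ; simple    = simple
      ; interior⊆ = interior⊆
      ; weight-≤  = λ {w} w≥0 → +-cancelʳ-≤ (w t)
          (subst₂ _≤_ (sym (interiorWeight-+ w q (≢⇒1≤len s≢t q))) (sym (interiorWeight-+ w p (≢⇒1≤len s≢t p)))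
            (sumOver-⊆ w≥0 q⊆p))
      }
      where
      interior⊆ : ∀ {v} → v ∈ interior q → v ∈ interior p
      interior⊆ {v} v∈ with ∈-++⁻ (interior p) (subst (v ∈_) (sym (interior-∷ʳ p (≢⇒1≤len s≢t p)))
                              (Sublist.lookup q⊆p (Sublist.lookup (interior⊆tailVertices q) v∈)))
      ... | inj₁ v∈p        = v∈p
      ... | inj₂ (here v≡t) = ⊥-elim (proj₂ (simple-interior q simple v∈) v≡t)

  -- Cuts, and deciding them

  vdist≥1⇒≢ : ∀ {n} {E : Graph n} {w : Fin n → ℚ} {s t} → VdistGe1 E w s t → s ≢ t
  vdist≥1⇒≢ vdist refl = 1≰0 (vdist done)

  cut-fromSimpleWalks : ∀ {n} {E : Graph n} {w : Fin n → ℚ} {X : Fin n → Bool} →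
    (∀ {s t} → VdistGe1 E w s t → (q : Walk E s t) → Simple q → Any (λ v → T (X v)) (interior q)) →
    IsCut E w X
  cut-fromSimpleWalks hit s t vdist p =
    let v , v∈ , Xv = find (hit vdist walk simple)
        v≢s , v≢t   = simple-interior walk simple v∈
    in v , interior⊆ v∈ , v≢s , v≢t , Xv
    where open Shortening (shortening (vdist≥1⇒≢ vdist) p)

  Fin⇒1≤ : ∀ {n} → Fin n → 1 ℕ.≤ n
  Fin⇒1≤ zero    = ℕ.s≤s ℕ.z≤n
  Fin⇒1≤ (suc _) = ℕ.s≤s ℕ.z≤n

  module _ {n : ℕ} (E : Graph n) where

    private
      extend : ∀ {s u t} → Dec (T (E s u)) → List (Walk E u t) → List (Walk E s t)
      extend (yes e) ps = map (step e) ps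
      extend (no _)  ps = []

      ∈-extend : ∀ {s u t} (d : Dec (T (E s u))) (e : T (E s u)) {ps} {p : Walk E u t} →
        p ∈ ps → step e p ∈ extend d ps
      ∈-extend (yes e′) e p∈ = subst (λ e → step e _ ∈ _) (T-irrelevant e′ e) (∈-map⁺ (step e′) p∈)
      ∈-extend (no ¬e)  e _  = ⊥-elim (¬e e)

      trivialWalks : (s t : Fin n) → List (Walk E s t)
      trivialWalks s t with s Fin.≟ t
      ... | yes refl = [ done ]
      ... | no  _    = []

      done∈trivialWalks : ∀ s → done ∈ trivialWalks s s
      done∈trivialWalks s with s Fin.≟ s
      ... | yes refl = here refl
      ... | no  s≢s  = ⊥-elim (s≢s refl)

    walksUpTo : ℕ → (s t : Fin n) → List (Walk E s t)
    walksUpTo zero    s t = trivialWalks s t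
    walksUpTo (suc L) s t = trivialWalks s t ++ concatMap (λ u → extend (T? (E s u)) (walksUpTo L u t)) (allFin n)

    ∈-walksUpTo : ∀ {s t} (p : Walk E s t) {L} → len p ℕ.≤ L → p ∈ walksUpTo L s t
    ∈-walksUpTo {s} done {zero}  _ = done∈trivialWalks s
    ∈-walksUpTo {s} done {suc L} _ = ∈-++⁺ˡ (done∈trivialWalks s)
    ∈-walksUpTo {s} {t} (step {u = u} e p) {suc L} (ℕ.s≤s len≤L) =
      ∈-++⁺ʳ (trivialWalks s t) (∈-concatMap⁺ (λ u → extend (T? (E s u)) (walksUpTo L u t))
        (Any.map (λ { refl → ∈-extend (T? (E s u)) e (∈-walksUpTo p len≤L) }) (∈-allFin u)))

    Hits : (Fin n → Bool) → ∀ {s t} → Walk E s t → Set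
    Hits X p = Any (λ v → T (X v)) (interior p)

    hits? : ∀ X {s t} (p : Walk E s t) → Dec (Hits X p)
    hits? X p = Any.any? (λ v → T? (X v)) (interior p)

    -- Every walk shortens to a simple one, so the walks of length at most n decide whether X is a cut.
    CutsShortWalks : (Fin n → ℚ) → (Fin n → Bool) → Set
    CutsShortWalks w X = ∀ s t → All (λ p → 1ℚ ≤ interiorWeight w p) (walksUpTo n s t) →
                                 All (Hits X) (walksUpTo n s t)

    cutsShortWalks? : ∀ w X → Dec (CutsShortWalks w X)
    cutsShortWalks? w X = FinP.all? λ s → FinP.all? λ t →
      All.all? (λ p → 1ℚ QP.≤? interiorWeight w p) (walksUpTo n s t) →-dec All.all? (hits? X) (walksUpTo n s t)

    module _ {w : Fin n → ℚ} (w≥0 : NonNeg w) where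

      vdist≥1-fromShortWalks : ∀ {s t} → All (λ p → 1ℚ ≤ interiorWeight w p) (walksUpTo n s t) → VdistGe1 E w s t
      vdist≥1-fromShortWalks {s} {t} short≥1 p with s Fin.≟ t
      ... | yes refl = ⊥-elim (1≰0 (All.lookup short≥1 (∈-walksUpTo done {n} ℕ.z≤n)))
      ... | no  s≢t  = QP.≤-trans (All.lookup short≥1 (∈-walksUpTo walk (ℕP.<⇒≤ (simple-len simple)))) (weight-≤ w≥0)
        where open Shortening (shortening s≢t p)

      isCut⇒cutsShortWalks : ∀ {X} → IsCut E w X → CutsShortWalks w X
      isCut⇒cutsShortWalks cut s t short≥1 = All.tabulate λ {p} _ →
        let v , v∈ , _ , _ , Xv = cut s t (vdist≥1-fromShortWalks short≥1) p in lose v∈ Xv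

      cutsShortWalks⇒isCut : ∀ {X} → CutsShortWalks w X → IsCut E w X
      cutsShortWalks⇒isCut cut = cut-fromSimpleWalks λ vdist q simple →
        All.lookup (cut _ _ (All.tabulate λ {r} _ → vdist r)) (∈-walksUpTo q (ℕP.<⇒≤ (simple-len simple)))

      isCut? : ∀ X → Dec (IsCut E w X)
      isCut? X = Dec.map′ cutsShortWalks⇒isCut isCut⇒cutsShortWalks (cutsShortWalks? w X)

    Link : (Fin n → Set) → Fin n → Fin n → Set
    Link P u x = Σ[ p ∈ Walk E u x ] (1 ℕ.≤ len p × All P (interior p))

    shortLink : ∀ {P u x} → Link P u x → Σ[ l ∈ Link P u x ] len (proj₁ l) ℕ.≤ n
    shortLink {u = u} l@(step e done , _) = l , Fin⇒1≤ u
    shortLink {u = u} {x} (step {u = y} e (step e′ p) , _ , Py ∷ P-interior) with y Fin.≟ x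
    ... | yes refl = (step e done , ℕ.s≤s ℕ.z≤n , []) , Fin⇒1≤ u
    ... | no  y≢x  =
      (step e walk , ℕ.s≤s ℕ.z≤n , All-interior-step e walk Py (All.tabulate λ v∈ → All.lookup P-interior (interior⊆ v∈))) ,
      simple-len simple
      where open Shortening (shortening y≢x (step e′ p))

    link? : ∀ {P} → Decidable P → ∀ u x → Dec (Link P u x)
    link? P? u x = Dec.map′
      (λ found → let p , _ , linkage = find found in p , linkage)
      (λ l → let (p , linkage) , len≤n = shortLink l in lose (∈-walksUpTo p len≤n) linkage)
      (Any.any? (λ p → (1 ℕ.≤? len p) ×-dec All.all? P? (interior p)) (walksUpTo n u x))

  costOf-∅ : ∀ {n} (c : Fin n → ℚ) → costOf c (λ _ → false) ≡ 0ℚ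
  costOf-∅ {n} c = trans (Σℚ-const {n} 0ℚ) (QP.*-zeroʳ (ℕtoℚ n))

  inner-nonNeg : ∀ {n} {c w : Fin n → ℚ} → NonNeg c → NonNeg w → 0ℚ ≤ inner c w
  inner-nonNeg c≥0 w≥0 = Σℚ-nonNeg (λ v → *-nonNeg (c≥0 v) (w≥0 v))

  ∅-isCut : ∀ {n} {E : Graph n} {w : Fin n → ℚ} → NonNeg w → Σℚ w < 1ℚ → IsCut E w (λ _ → false)
  ∅-isCut w≥0 W<1 = cut-fromSimpleWalks λ vdist q simple →
    ⊥-elim (QP.<-irrefl refl (QP.≤-<-trans (QP.≤-trans (vdist q) (simple-interiorWeight-≤ w≥0 simple)) W<1))

  module _ {m : ℕ} (E : Graph m) {w : Fin m → ℚ} (w≥0 : NonNeg w) where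

    threshold : Fin m → Bool
    threshold v = isYes (1ℚ QP.≤? ℕtoℚ m * w v)

    threshold-isCut : IsCut E w threshold
    threshold-isCut = cut-fromSimpleWalks λ vdist q simple →
      hit vdist q simple (Any.any? (λ v → 1ℚ QP.≤? ℕtoℚ m * w v) (interior q))
      where
      hit : ∀ {s t} → VdistGe1 E w s t → (q : Walk E s t) → Simple q →
        Dec (Any (λ v → 1ℚ ≤ ℕtoℚ m * w v) (interior q)) → Any (λ v → T (threshold v)) (interior q)
      hit _     _ _      (yes heavy) = Any.map fromWitness heavy
      hit vdist q simple (no  none)  =
        ⊥-elim (ℕP.<-irrefl refl (ℕP.<-≤-trans (simple-len simple) (ℕtoℚ-cancel-≤ m≤len)))
        where
        open QP.≤-Reasoning
        light : ∀ {v} → v ∈ interior q → ℕtoℚ m * w v < 1ℚ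
        light v∈ = QP.≰⇒> (All.lookup (AllP.¬Any⇒All¬ _ none) v∈)
        m≤len : ℕtoℚ m ≤ ℕtoℚ (len q)
        m≤len = begin
          ℕtoℚ m                                    ≡⟨ sym (QP.*-identityʳ (ℕtoℚ m)) ⟩
          ℕtoℚ m * 1ℚ                               ≤⟨ *-monoˡ-≤ (ℕtoℚ-nonNeg m) (vdist q) ⟩
          ℕtoℚ m * interiorWeight w q               ≡⟨ sym (sumOver-*ˡ (ℕtoℚ m) w (interior q)) ⟩
          sumOver (λ v → ℕtoℚ m * w v) (interior q) ≤⟨ sumOver-mono-≤ (interior q) (λ v∈ → QP.<⇒≤ (light v∈)) ⟩
          sumOver (λ _ → 1ℚ) (interior q)           ≡⟨ sumOver-1 (interior q) ⟩
          ℕtoℚ (length (interior q))                ≤⟨ ℕtoℚ-mono-≤ (length-interior-≤ q) ⟩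
          ℕtoℚ (len q)                              ∎

    threshold-cost : (c : Fin m → ℚ) → NonNeg c → costOf c threshold ≤ inner c w * ℕtoℚ m
    threshold-cost c c≥0 = begin
      costOf c threshold                   ≤⟨ Σℚ-mono-≤ (λ v → pointwise v (1ℚ QP.≤? ℕtoℚ m * w v)) ⟩
      Σℚ (λ v → ℕtoℚ m * (c v * w v))      ≡⟨ Σℚ-*ˡ (ℕtoℚ m) (λ v → c v * w v) ⟩
      ℕtoℚ m * inner c w                   ≡⟨ QP.*-comm (ℕtoℚ m) (inner c w) ⟩
      inner c w * ℕtoℚ m                   ∎
      where
      open QP.≤-Reasoning
      pointwise : ∀ v (d : Dec (1ℚ ≤ ℕtoℚ m * w v)) → (if isYes d then c v else 0ℚ) ≤ ℕtoℚ m * (c v * w v)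
      pointwise v (yes 1≤mw) = QP.≤-trans (QP.≤-reflexive (sym (QP.*-identityʳ (c v))))
        (QP.≤-trans (*-monoˡ-≤ (c≥0 v) 1≤mw)
          (QP.≤-reflexive (solve 3 (λ c m w → c :* (m :* w) := m :* (c :* w)) refl (c v) (ℕtoℚ m) (w v))))
      pointwise v (no  _)    = *-nonNeg (ℕtoℚ-nonNeg m) (*-nonNeg (c≥0 v) (w≥0 v))

  goodU-size : ∀ m W → GoodU m W m
  goodU-size m W E w w≥0 _ = threshold E w≥0 , threshold-isCut E w≥0 , threshold-cost E w≥0 (λ _ → 1ℚ) (λ _ → QP.<⇒≤ 0<1)

  goodU-mono : ∀ {m W u M} → u ℕ.≤ M → GoodU m W u → GoodU m W M
  goodU-mono {M = M} u≤M good E w w≥0 ΣW =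
    let X , cut , size≤ = good E w w≥0 ΣW
    in X , cut , QP.≤-trans size≤ (*-monoˡ-≤ (inner-nonNeg (λ _ → QP.<⇒≤ 0<1) w≥0) (ℕtoℚ-mono-≤ u≤M))

  -- Rounding the weights

  module Rounding {n : ℕ} {w : Fin n → ℚ} (w≥0 : NonNeg w) where

    Heavy : Fin n → Set
    Heavy v = 1ℚ < ℕtoℚ n * (ℕtoℚ 2 * w v)

    heavy? : ∀ v → Dec (Heavy v)
    heavy? v = 1ℚ QP.<? ℕtoℚ n * (ℕtoℚ 2 * w v)

    roundedBy : ∀ {v} → Dec (Heavy v) → ℚ
    roundedBy {v} (yes _) = 1ℚ ⊓ (ℕtoℚ 2 * w v)
    roundedBy     (no  _) = 0ℚ

    rounded : Fin n → ℚ
    rounded v = roundedBy (heavy? v)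

    2w-nonNeg : ∀ v → 0ℚ ≤ ℕtoℚ 2 * w v
    2w-nonNeg v = *-nonNeg (ℕtoℚ-nonNeg 2) (w≥0 v)

    rounded-nonNeg : NonNeg rounded
    rounded-nonNeg v = byCases (heavy? v)
      where
      byCases : (d : Dec (Heavy v)) → 0ℚ ≤ roundedBy d
      byCases (yes _) = QP.⊓-glb (QP.<⇒≤ 0<1) (2w-nonNeg v)
      byCases (no  _) = QP.≤-refl

    rounded-≤-1 : ∀ v → rounded v ≤ 1ℚ
    rounded-≤-1 v = byCases (heavy? v)
      where
      byCases : (d : Dec (Heavy v)) → roundedBy d ≤ 1ℚ
      byCases (yes _) = QP.p⊓q≤p 1ℚ (ℕtoℚ 2 * w v)
      byCases (no  _) = QP.<⇒≤ 0<1

    rounded-≤-2w : ∀ v → rounded v ≤ ℕtoℚ 2 * w v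
    rounded-≤-2w v = byCases (heavy? v)
      where
      byCases : (d : Dec (Heavy v)) → roundedBy d ≤ ℕtoℚ 2 * w v
      byCases (yes _) = QP.p⊓q≤q 1ℚ (ℕtoℚ 2 * w v)
      byCases (no  _) = 2w-nonNeg v

    rounded-light : ∀ {v} → ¬ Heavy v → rounded v ≡ 0ℚ
    rounded-light {v} light = byCases (heavy? v)
      where
      byCases : (d : Dec (Heavy v)) → roundedBy d ≡ 0ℚ
      byCases (yes heavy) = ⊥-elim (light heavy)
      byCases (no  _)     = refl

    2w-≤-rounded : ∀ v → rounded v < 1ℚ → ℕtoℚ n * (ℕtoℚ 2 * w v) ≤ ℕtoℚ n * rounded v + 1ℚ
    2w-≤-rounded v = byCases (heavy? v)
      where
      n2w : ℚ
      n2w = ℕtoℚ n * (ℕtoℚ 2 * w v)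
      byCases : (d : Dec (Heavy v)) → roundedBy d < 1ℚ → n2w ≤ ℕtoℚ n * roundedBy d + 1ℚ
      byCases (no  light) _ = subst (n2w ≤_) (sym (trans (cong (_+ 1ℚ) (QP.*-zeroʳ (ℕtoℚ n))) (QP.+-identityˡ 1ℚ))) (QP.≮⇒≥ light)
      byCases (yes _) r<1 = belowCap (1ℚ QP.≤? ℕtoℚ 2 * w v)
        where
        open QP.≤-Reasoning
        belowCap : Dec (1ℚ ≤ ℕtoℚ 2 * w v) → n2w ≤ ℕtoℚ n * (1ℚ ⊓ (ℕtoℚ 2 * w v)) + 1ℚ
        belowCap (yes 1≤2w) = ⊥-elim (QP.<-irrefl (QP.p≤q⇒p⊓q≡p 1≤2w) r<1)
        belowCap (no  1≰2w) = begin
          n2w                                    ≡⟨ sym (QP.+-identityʳ n2w) ⟩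
          n2w + 0ℚ                               ≤⟨ QP.+-monoʳ-≤ n2w (QP.<⇒≤ 0<1) ⟩
          n2w + 1ℚ                               ≡⟨ cong (λ r → ℕtoℚ n * r + 1ℚ) (sym (QP.p≥q⇒p⊓q≡q (QP.<⇒≤ (QP.≰⇒> 1≰2w)))) ⟩
          ℕtoℚ n * (1ℚ ⊓ (ℕtoℚ 2 * w v)) + 1ℚ    ∎

    sumOver-rounded-≥1 : ∀ (xs : List (Fin n)) → length xs ℕ.≤ n → 1ℚ ≤ sumOver w xs → 1ℚ ≤ sumOver rounded xs
    sumOver-rounded-≥1 []         _       1≤0 = ⊥-elim (1≰0 1≤0)
    sumOver-rounded-≥1 xs@(x ∷ _) |xs|≤n 1≤Σw = byCases (Any.any? (λ v → 1ℚ QP.≤? rounded v) xs)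
      where
      byCases : Dec (Any (λ v → 1ℚ ≤ rounded v) xs) → 1ℚ ≤ sumOver rounded xs
      byCases (yes capped) = let v , v∈ , 1≤r = find capped in QP.≤-trans 1≤r (∈⇒≤sumOver rounded-nonNeg v∈)
      byCases (no uncapped) = *-cancelˡ-≤ {ℕtoℚ n} {1ℚ} {sumOver rounded xs} 0<n
        (+-cancelʳ-≤ {ℕtoℚ n * 1ℚ} {ℕtoℚ n * sumOver rounded xs} (ℕtoℚ n) (begin
          ℕtoℚ n * 1ℚ + ℕtoℚ n
            ≡⟨ solve 1 (λ m → m :* con 1ℚ :+ m := m :* (con (ℕtoℚ 2) :* con 1ℚ)) refl (ℕtoℚ n) ⟩
          ℕtoℚ n * (ℕtoℚ 2 * 1ℚ)
            ≤⟨ *-monoˡ-≤ (ℕtoℚ-nonNeg n) (*-monoˡ-≤ (ℕtoℚ-nonNeg 2) 1≤Σw) ⟩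
          ℕtoℚ n * (ℕtoℚ 2 * sumOver w xs)
            ≡⟨ sym (trans (sumOver-*ˡ (ℕtoℚ n) (λ v → ℕtoℚ 2 * w v) xs) (cong (ℕtoℚ n *_) (sumOver-*ˡ (ℕtoℚ 2) w xs))) ⟩
          sumOver (λ v → ℕtoℚ n * (ℕtoℚ 2 * w v)) xs
            ≤⟨ sumOver-mono-≤ xs (λ {v} v∈ → 2w-≤-rounded v (QP.≰⇒> (All.lookup (AllP.¬Any⇒All¬ xs uncapped) v∈))) ⟩
          sumOver (λ v → ℕtoℚ n * rounded v + 1ℚ) xs
            ≡⟨ trans (sumOver-+ (λ v → ℕtoℚ n * rounded v) (λ _ → 1ℚ) xs) (cong₂ _+_ (sumOver-*ˡ (ℕtoℚ n) rounded xs) (sumOver-1 xs)) ⟩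
          ℕtoℚ n * sumOver rounded xs + ℕtoℚ (length xs)
            ≤⟨ QP.+-monoʳ-≤ (ℕtoℚ n * sumOver rounded xs) (ℕtoℚ-mono-≤ |xs|≤n) ⟩
          ℕtoℚ n * sumOver rounded xs + ℕtoℚ n ∎))
        where
        open QP.≤-Reasoning
        0<n : 0ℚ < ℕtoℚ n
        0<n = QP.<-≤-trans 0<1 (ℕtoℚ-mono-≤ {1} {n} (Fin⇒1≤ x))

    rounded-vdist≥1 : ∀ {E : Graph n} {s t} → VdistGe1 E w s t → VdistGe1 E rounded s t
    rounded-vdist≥1 vdist p = QP.≤-trans walk≥1 (weight-≤ rounded-nonNeg)
      where
      open Shortening (shortening (vdist≥1⇒≢ vdist) p)
      |interior|≤n : length (interior walk) ℕ.≤ n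
      |interior|≤n = ℕP.≤-trans (length-interior-≤ walk) (ℕP.<⇒≤ (simple-len simple))
      walk≥1 : 1ℚ ≤ interiorWeight rounded walk
      walk≥1 = sumOver-rounded-≥1 (interior walk) |interior|≤n (vdist walk)

  -- Blowing up the vertices

  total : ∀ {n} → (Fin n → ℕ) → ℕ
  total {zero}  K = 0
  total {suc n} K = K zero ℕ.+ total (λ v → K (suc v))

  copy : ∀ {n} (K : Fin n → ℕ) v → Fin (K v) → Fin (total K)
  copy {suc n} K zero    i = i ↑ˡ total (λ v → K (suc v))
  copy {suc n} K (suc v) i = K zero ↑ʳ copy (λ v → K (suc v)) v i

  original : ∀ {n} (K : Fin n → ℕ) → Fin (total K) → Fin n
  original {suc n} K a = Sum.[ (λ _ → zero) , (λ b → suc (original (λ v → K (suc v)) b)) ] (splitAt (K zero) a)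

  original-copy : ∀ {n} (K : Fin n → ℕ) v i → original K (copy K v i) ≡ v
  original-copy {suc n} K zero    i rewrite FinP.splitAt-↑ˡ (K zero) i (total (λ v → K (suc v))) = refl
  original-copy {suc n} K (suc v) i
    rewrite FinP.splitAt-↑ʳ (K zero) (total (λ v → K (suc v))) (copy (λ v → K (suc v)) v i) =
    cong suc (original-copy (λ v → K (suc v)) v i)

  Σℚ-↑ : ∀ m {k} (f : Fin (m ℕ.+ k) → ℚ) → Σℚ f ≡ Σℚ (λ i → f (i ↑ˡ k)) + Σℚ (λ j → f (m ↑ʳ j))
  Σℚ-↑ zero    f = sym (QP.+-identityˡ _)
  Σℚ-↑ (suc m) {k} f rewrite Σℚ-↑ m (λ i → f (suc i)) =
    sym (QP.+-assoc (f zero) (Σℚ (λ i → f (suc (i ↑ˡ k)))) (Σℚ (λ j → f (suc (m ↑ʳ j)))))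

  Σℚ-copies : ∀ {n} (K : Fin n → ℕ) (f : Fin (total K) → ℚ) → Σℚ f ≡ Σℚ (λ v → Σℚ (λ i → f (copy K v i)))
  Σℚ-copies {zero}  K f = refl
  Σℚ-copies {suc n} K f rewrite Σℚ-↑ (K zero) f =
    cong (Σℚ (λ i → f (i ↑ˡ total (λ v → K (suc v)))) +_) (Σℚ-copies (λ v → K (suc v)) (λ j → f (K zero ↑ʳ j)))

  module BlowUp {n : ℕ} (E : Graph n) {Light : Fin n → Set} (light? : Decidable Light) (k : Fin n → ℕ) where

    K : Fin n → ℕ
    K v = suc (k v)

    -- Edges bypass light vertices, so that a cut never needs to contain them.
    E′ : Graph (total K)
    E′ a b = isYes (link? E light? (original K a) (original K b))

    firstCopy : Fin n → Fin (total K)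
    firstCopy v = copy K v zero

    lift : (Fin n → ℚ) → Fin (total K) → ℚ
    lift u a = u (original K a)

    module _ {u : Fin n → ℚ} (light⇒0 : ∀ {v} → Light v → u v ≡ 0ℚ) where

      link-tailWeight : ∀ {x y} (l : Link E Light x y) → sumOver u (tailVertices (proj₁ l)) ≡ u y
      link-tailWeight {y = y} (p , 1≤len , light) = begin
        sumOver u (tailVertices p) ≡⟨ sym (interiorWeight-+ u p 1≤len) ⟩
        interiorWeight u p + u y   ≡⟨ cong (_+ u y) (sumOver-zero (All.map light⇒0 light)) ⟩
        0ℚ + u y                   ≡⟨ QP.+-identityˡ (u y) ⟩
        u y                        ∎
        where open ≡-Reasoning

      project : ∀ {a b} (r : Walk E′ a b) →
        Σ[ p ∈ Walk E (original K a) (original K b) ] sumOver u (tailVertices p) ≡ sumOver (lift u) (tailVertices r)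
      project done = done , refl
      project (step {u = a′} e r) =
        let l = toWitness e
            p , p≡r = project r
        in proj₁ l ++ʷ p , (begin
          sumOver u (tailVertices (proj₁ l ++ʷ p))
            ≡⟨ cong (sumOver u) (tailVertices-++ʷ (proj₁ l) p) ⟩
          sumOver u (tailVertices (proj₁ l) ++ tailVertices p)
            ≡⟨ sumOver-++ u (tailVertices (proj₁ l)) (tailVertices p) ⟩
          sumOver u (tailVertices (proj₁ l)) + sumOver u (tailVertices p)
            ≡⟨ cong₂ _+_ (link-tailWeight l) p≡r ⟩
          lift u a′ + sumOver (lift u) (tailVertices r) ∎)
        where open ≡-Reasoning

      vdist≥1-lift : ∀ {a b} → VdistGe1 E u (original K a) (original K b) → VdistGe1 E′ (lift u) a b
      vdist≥1-lift {a} {b} vdist r =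
        let p , p≡r = project r
            a≢b : a ≢ b
            a≢b a≡b = vdist≥1⇒≢ vdist (cong (original K) a≡b)
        in +-cancelʳ-≤ (lift u b) (begin
          1ℚ + lift u b                        ≤⟨ QP.+-monoˡ-≤ (lift u b) (vdist p) ⟩
          interiorWeight u p + lift u b        ≡⟨ interiorWeight-+ u p (≢⇒1≤len (vdist≥1⇒≢ vdist) p) ⟩
          sumOver u (tailVertices p)           ≡⟨ p≡r ⟩
          sumOver (lift u) (tailVertices r)    ≡⟨ sym (interiorWeight-+ (lift u) r (≢⇒1≤len a≢b r)) ⟩
          interiorWeight (lift u) r + lift u b ∎)
        where open QP.≤-Reasoning

    segmentEdge : ∀ {a b x y z} → original K a ≡ x → original K b ≡ z →
      (seg : Walk E x y) → All Light (tailVertices seg) → (e : T (E y z)) → T (E′ a b)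
    segmentEdge refl refl seg light e = fromWitness
      (seg ▹ e , subst (1 ℕ.≤_) (sym (len-▹ seg e)) (ℕ.s≤s ℕ.z≤n) , subst (All Light) (sym (interior-▹ seg e)) light)

    module _ (X′ : Fin (total K) → Bool) where

      AllCopiesCut : Fin n → Set
      AllCopiesCut v = ¬ Light v × (∀ i → T (X′ (copy K v i)))

      allCopiesCut? : ∀ v → Dec (AllCopiesCut v)
      allCopiesCut? v = ¬? (light? v) ×-dec FinP.all? (λ i → T? (X′ (copy K v i)))

      liftedCut : Fin n → Bool
      liftedCut v = isYes (allCopiesCut? v)

      freeCopy : ∀ {v} → ¬ T (liftedCut v) → ¬ Light v → ∃[ i ] ¬ T (X′ (copy K v i))
      freeCopy {v} v∉X heavy =
        FinP.¬∀⟶∃¬ (K v) _ (λ i → T? (X′ (copy K v i))) (λ all∈X′ → v∉X (fromWitness (heavy , all∈X′)))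

      liftWalk : ∀ {x y z t} (a : Fin (total K)) → original K a ≡ x →
        (seg : Walk E x y) → All Light (tailVertices seg) → (e : T (E y z)) (p : Walk E z t) →
        All (λ v → ¬ T (liftedCut v)) (interior (step e p)) →
        Σ[ r ∈ Walk E′ a (firstCopy t) ] All (λ b → ¬ T (X′ b)) (interior r)
      liftWalk {t = t} a a↦x seg light e done _ =
        step (segmentEdge a↦x (original-copy K t zero) seg light e) done , []
      liftWalk {z = z} a a↦x seg light e (step e′ p) (z∉X ∷ rest) with light? z | freeCopy z∉X
      ... | yes light-z | _ = liftWalk a a↦x (seg ▹ e)
              (subst (All Light) (sym (tailVertices-▹ seg e)) (AllP.++⁺ light (light-z ∷ []))) e′ p rest
      ... | no  heavy   | free-copy =
        let i , free = free-copy heavy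
            r , r-free = liftWalk (copy K z i) (original-copy K z i) done [] e′ p rest
        in step (segmentEdge a↦x (original-copy K z i) seg light e) r , All-interior-step _ r free r-free

      liftedCut-isCut : ∀ {u : Fin n → ℚ} → (∀ {v} → Light v → u v ≡ 0ℚ) →
        IsCut E′ (lift u) X′ → IsCut E u liftedCut
      liftedCut-isCut {u} light⇒0 cut′ = cut-fromSimpleWalks hit
        where
        hit : ∀ {s t} → VdistGe1 E u s t → (q : Walk E s t) → Simple q → Any (λ v → T (liftedCut v)) (interior q)
        hit vdist done _ = ⊥-elim (vdist≥1⇒≢ vdist refl)
        hit {s} {t} vdist (step e q) _ = byCases (Any.any? (λ v → T? (liftedCut v)) (interior (step e q)))
          where
          byCases : Dec (Any (λ v → T (liftedCut v)) (interior (step e q))) → Any (λ v → T (liftedCut v)) (interior (step e q))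
          byCases (yes found) = found
          byCases (no  none)  =
            let r , r-free              = liftWalk (firstCopy s) (original-copy K s zero) done [] e q (AllP.¬Any⇒All¬ _ none)
                _ , b∈ , _ , _ , X′b    = cut′ (firstCopy s) (firstCopy t) vdist′ r
            in ⊥-elim (All.lookup r-free b∈ X′b)
            where
            vdist′ : VdistGe1 E′ (lift u) (firstCopy s) (firstCopy t)
            vdist′ = vdist≥1-lift light⇒0
              (subst₂ (VdistGe1 E u) (sym (original-copy K s zero)) (sym (original-copy K t zero)) vdist)

      liftedCut-cost : ∀ (c : Fin n → ℚ) {Λ} → 0ℚ ≤ Λ → (∀ {v} → ¬ Light v → c v ≤ Λ * ℕtoℚ (K v)) →
        costOf c liftedCut ≤ Λ * costOf (λ _ → 1ℚ) X′
      liftedCut-cost c {Λ} 0≤Λ heavy⇒c≤ΛK = begin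
        costOf c liftedCut                                ≤⟨ Σℚ-mono-≤ (λ v → pointwise v (allCopiesCut? v)) ⟩
        Σℚ (λ v → Λ * Σℚ (λ i → indicator (copy K v i)))  ≡⟨ Σℚ-*ˡ Λ (λ v → Σℚ (λ i → indicator (copy K v i))) ⟩
        Λ * Σℚ (λ v → Σℚ (λ i → indicator (copy K v i)))  ≡⟨ cong (Λ *_) (sym (Σℚ-copies K indicator)) ⟩
        Λ * costOf (λ _ → 1ℚ) X′                          ∎
        where
        open QP.≤-Reasoning
        indicator : Fin (total K) → ℚ
        indicator b = if X′ b then 1ℚ else 0ℚ
        indicator-nonNeg : NonNeg indicator
        indicator-nonNeg b with X′ b
        ... | true  = QP.<⇒≤ 0<1
        ... | false = QP.≤-refl
        indicator-∈ : ∀ {b} → T (X′ b) → indicator b ≡ 1ℚ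
        indicator-∈ {b} b∈ with X′ b
        ... | true = refl
        pointwise : ∀ v (d : Dec (AllCopiesCut v)) → (if isYes d then c v else 0ℚ) ≤ Λ * Σℚ (λ i → indicator (copy K v i))
        pointwise v (yes (heavy , all∈X′)) = QP.≤-trans (heavy⇒c≤ΛK heavy) (QP.≤-reflexive (cong (Λ *_) (begin-equality
          ℕtoℚ (K v)                          ≡⟨ sym (QP.*-identityʳ (ℕtoℚ (K v))) ⟩
          ℕtoℚ (K v) * 1ℚ                     ≡⟨ sym (Σℚ-const {K v} 1ℚ) ⟩
          Σℚ {K v} (λ _ → 1ℚ)                 ≡⟨ Σℚ-cong (λ i → sym (indicator-∈ (all∈X′ i))) ⟩
          Σℚ (λ i → indicator (copy K v i))   ∎)))
        pointwise v (no  _) = *-nonNeg 0≤Λ (Σℚ-nonNeg (λ i → indicator-nonNeg (copy K v i)))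

    Σℚ-lift : ∀ (u : Fin n → ℚ) → Σℚ (lift u) ≡ Σℚ (λ v → ℕtoℚ (K v) * u v)
    Σℚ-lift u = trans (Σℚ-copies K (lift u))
      (Σℚ-cong λ v → trans (Σℚ-cong (λ i → cong u (original-copy K v i))) (Σℚ-const {K v} (u v)))

    total-ℚ : ℕtoℚ (total K) ≡ Σℚ (λ v → ℕtoℚ (K v))
    total-ℚ = begin
      ℕtoℚ (total K)                          ≡⟨ sym (QP.*-identityʳ _) ⟩
      ℕtoℚ (total K) * 1ℚ                     ≡⟨ sym (Σℚ-const {total K} 1ℚ) ⟩
      Σℚ (lift (λ _ → 1ℚ))                    ≡⟨ Σℚ-lift (λ _ → 1ℚ) ⟩
      Σℚ (λ v → ℕtoℚ (K v) * 1ℚ)              ≡⟨ Σℚ-cong (λ v → QP.*-identityʳ (ℕtoℚ (K v))) ⟩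
      Σℚ (λ v → ℕtoℚ (K v))                   ∎
      where open ≡-Reasoning

  -- Scaling the costs

  *-ℕtoℚ-suc : ∀ Λ B → Λ * ℕtoℚ (suc B) ≡ Λ * ℕtoℚ B + Λ
  *-ℕtoℚ-suc Λ B rewrite ℕtoℚ-+ 1 B = solve 2 (λ Λ b → Λ :* (con 1ℚ :+ b) := Λ :* b :+ Λ) refl Λ (ℕtoℚ B)

  ceilingMultiple : ∀ {Λ y} → 0ℚ ≤ Λ → 0ℚ ≤ y → ∀ B → y ≤ Λ * ℕtoℚ B →
    ∃[ k ] (y ≤ Λ * ℕtoℚ (suc k) × Λ * ℕtoℚ (suc k) ≤ y + Λ)
  ceilingMultiple {Λ} {y} 0≤Λ 0≤y zero y≤Λ*0 = 0 , (begin
    y         ≤⟨ y≤Λ*0 ⟩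
    Λ * 0ℚ    ≡⟨ QP.*-zeroʳ Λ ⟩
    0ℚ        ≤⟨ 0≤Λ ⟩
    Λ         ≡⟨ sym (QP.*-identityʳ Λ) ⟩
    Λ * 1ℚ    ∎) , (begin
    Λ * 1ℚ    ≡⟨ trans (QP.*-identityʳ Λ) (sym (QP.+-identityˡ Λ)) ⟩
    0ℚ + Λ    ≤⟨ QP.+-monoˡ-≤ Λ 0≤y ⟩
    y + Λ     ∎)
    where open QP.≤-Reasoning
  ceilingMultiple {Λ} {y} 0≤Λ 0≤y (suc B) y≤Λ[1+B] = byCases (y QP.≤? Λ * ℕtoℚ B)
    where
    byCases : Dec (y ≤ Λ * ℕtoℚ B) → ∃[ k ] (y ≤ Λ * ℕtoℚ (suc k) × Λ * ℕtoℚ (suc k) ≤ y + Λ)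
    byCases (yes y≤ΛB) = ceilingMultiple 0≤Λ 0≤y B y≤ΛB
    byCases (no  y≰ΛB) = B , y≤Λ[1+B] ,
      subst (_≤ y + Λ) (sym (*-ℕtoℚ-suc Λ B)) (QP.+-monoˡ-≤ Λ (QP.<⇒≤ (QP.≰⇒> y≰ΛB)))

  costOf-*ˡ : ∀ {n} a (c : Fin n → ℚ) X → costOf (λ v → a * c v) X ≡ a * costOf c X
  costOf-*ˡ a c X = trans (Σℚ-cong pointwise) (Σℚ-*ˡ a (λ v → if X v then c v else 0ℚ))
    where
    pointwise : ∀ v → (if X v then a * c v else 0ℚ) ≡ a * (if X v then c v else 0ℚ)
    pointwise v with X v
    ... | true  = refl
    ... | false = sym (QP.*-zeroʳ a)

  isCut-weaken : ∀ {n} {E : Graph n} {w u : Fin n → ℚ} {X} →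
    (∀ {s t} → VdistGe1 E w s t → VdistGe1 E u s t) → IsCut E u X → IsCut E w X
  isCut-weaken w⇒u cut s t vdist = cut s t (w⇒u vdist)

  n[2N+1]≤8n² : ∀ {n N} → 1 ℕ.≤ n → N ℕ.≤ suc n → n ℕ.* (2 ℕ.* N ℕ.+ 1) ℕ.≤ 8 ℕ.* (n ℕ.* n)
  n[2N+1]≤8n² {suc m} {N} _ N≤2+m = begin
    suc m ℕ.* (2 ℕ.* N ℕ.+ 1)
      ≤⟨ ℕP.*-monoʳ-≤ (suc m) (ℕP.+-monoˡ-≤ 1 (ℕP.*-monoʳ-≤ 2 N≤2+m)) ⟩
    suc m ℕ.* (2 ℕ.* suc (suc m) ℕ.+ 1)
      ≤⟨ ℕP.*-monoʳ-≤ (suc m) (ℕP.m≤m+n _ (6 ℕ.* m ℕ.+ 3)) ⟩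
    suc m ℕ.* (2 ℕ.* suc (suc m) ℕ.+ 1 ℕ.+ (6 ℕ.* m ℕ.+ 3))
      ≡⟨ ℕS.solve 1 (λ m → (ℕS.con 1 ℕS.:+ m) ℕS.:* (ℕS.con 2 ℕS.:* (ℕS.con 2 ℕS.:+ m) ℕS.:+ ℕS.con 1 ℕS.:+ (ℕS.con 6 ℕS.:* m ℕS.:+ ℕS.con 3))
                      ℕS.:= ℕS.con 8 ℕS.:* ((ℕS.con 1 ℕS.:+ m) ℕS.:* (ℕS.con 1 ℕS.:+ m))) refl m ⟩
    8 ℕ.* (suc m ℕ.* suc m) ∎
    where
    open ℕP.≤-Reasoning
    module ℕS = Data.Nat.Solver.+-*-Solver

  1≤Σℚ⇒1≤n : ∀ {n} {w : Fin n → ℚ} → 1ℚ ≤ Σℚ w → 1 ℕ.≤ n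
  1≤Σℚ⇒1≤n {zero}  1≤0 = ⊥-elim (1≰0 1≤0)
  1≤Σℚ⇒1≤n {suc n} _   = ℕ.s≤s ℕ.z≤n

  module Reduction {n : ℕ} (E : Graph n) {c w : Fin n → ℚ} (c≥0 : NonNeg c) (w≥0 : NonNeg w)
                   (Λ>0 : 0ℚ < inner c w) (W≥1 : 1ℚ ≤ Σℚ w) where

    open Rounding w≥0

    Λ W W₂ : ℚ
    Λ  = inner c w
    W  = Σℚ w
    W₂ = Σℚ rounded

    Λ≥0 : 0ℚ ≤ Λ
    Λ≥0 = QP.<⇒≤ Λ>0

    1≤n : 1 ℕ.≤ n
    1≤n = 1≤Σℚ⇒1≤n W≥1

    W₂≤n : W₂ ≤ ℕtoℚ n
    W₂≤n = QP.≤-trans (Σℚ-mono-≤ rounded-≤-1) (QP.≤-reflexive (trans (Σℚ-const {n} 1ℚ) (QP.*-identityʳ (ℕtoℚ n))))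

    W₂≤2W : W₂ ≤ ℕtoℚ 2 * W
    W₂≤2W = QP.≤-trans (Σℚ-mono-≤ rounded-≤-2w) (QP.≤-reflexive (Σℚ-*ˡ (ℕtoℚ 2) w))

    private
      roundedTotal-ceiling : ∃[ k ] (W₂ ≤ 1ℚ * ℕtoℚ (suc k) × 1ℚ * ℕtoℚ (suc k) ≤ W₂ + 1ℚ)
      roundedTotal-ceiling = ceilingMultiple (QP.<⇒≤ 0<1) (Σℚ-nonNeg rounded-nonNeg) n
        (subst (W₂ ≤_) (sym (QP.*-identityˡ (ℕtoℚ n))) W₂≤n)

    N : ℕ
    N = suc (proj₁ roundedTotal-ceiling)

    W₂≤N : W₂ ≤ ℕtoℚ N
    W₂≤N = subst (W₂ ≤_) (QP.*-identityˡ (ℕtoℚ N)) (proj₁ (proj₂ roundedTotal-ceiling))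

    0<N : 0ℚ < ℕtoℚ N
    0<N = ℕtoℚ-suc-pos (proj₁ roundedTotal-ceiling)

    N≤W₂+1 : ℕtoℚ N ≤ W₂ + 1ℚ
    N≤W₂+1 = subst (_≤ W₂ + 1ℚ) (QP.*-identityˡ (ℕtoℚ N)) (proj₂ (proj₂ roundedTotal-ceiling))

    heavyCostBy : ∀ {v} → Dec (Heavy v) → ℚ
    heavyCostBy {v} (yes _) = c v
    heavyCostBy     (no  _) = 0ℚ

    heavyCost : Fin n → ℚ
    heavyCost v = heavyCostBy (heavy? v)

    heavyCost-heavy : ∀ {v} → Heavy v → heavyCost v ≡ c v
    heavyCost-heavy {v} heavy = byCases (heavy? v)
      where
      byCases : (d : Dec (Heavy v)) → heavyCostBy d ≡ c v
      byCases (yes _)     = refl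
      byCases (no  light) = ⊥-elim (light heavy)

    heavyCost-nonNeg : NonNeg heavyCost
    heavyCost-nonNeg v = byCases (heavy? v)
      where
      byCases : (d : Dec (Heavy v)) → 0ℚ ≤ heavyCostBy d
      byCases (yes _) = c≥0 v
      byCases (no  _) = QP.≤-refl

    -- A heavy vertex carries more than 1/(2n) of the weight, so its cost is at most 2n times its share of Λ.
    heavyCost-≤ : ∀ v → heavyCost v ≤ ℕtoℚ n * (ℕtoℚ 2 * (c v * w v))
    heavyCost-≤ v = byCases (heavy? v)
      where
      byCases : (d : Dec (Heavy v)) → heavyCostBy d ≤ ℕtoℚ n * (ℕtoℚ 2 * (c v * w v))
      byCases (yes heavy) = QP.≤-trans (QP.≤-reflexive (sym (QP.*-identityʳ (c v))))
        (QP.≤-trans (*-monoˡ-≤ (c≥0 v) (QP.<⇒≤ heavy))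
          (QP.≤-reflexive (solve 4 (λ c m t x → c :* (m :* (t :* x)) := m :* (t :* (c :* x))) refl (c v) (ℕtoℚ n) (ℕtoℚ 2) (w v))))
      byCases (no  _)     = *-nonNeg (ℕtoℚ-nonNeg n) (*-nonNeg (ℕtoℚ-nonNeg 2) (*-nonNeg (c≥0 v) (w≥0 v)))

    heavyCost-≤-c : ∀ v → heavyCost v ≤ c v
    heavyCost-≤-c v = byCases (heavy? v)
      where
      byCases : (d : Dec (Heavy v)) → heavyCostBy d ≤ c v
      byCases (yes _) = QP.≤-refl
      byCases (no  _) = c≥0 v

    heavyCost-rounded : ∀ v → heavyCost v * rounded v ≤ ℕtoℚ 2 * (c v * w v)
    heavyCost-rounded v = begin
      heavyCost v * rounded v        ≤⟨ *-monoʳ-≤ (rounded-nonNeg v) (heavyCost-≤-c v) ⟩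
      c v * rounded v                ≤⟨ *-monoˡ-≤ (c≥0 v) (rounded-≤-2w v) ⟩
      c v * (ℕtoℚ 2 * w v)           ≡⟨ solve 3 (λ c t x → c :* (t :* x) := t :* (c :* x)) refl (c v) (ℕtoℚ 2) (w v) ⟩
      ℕtoℚ 2 * (c v * w v)           ∎
      where open QP.≤-Reasoning

    Σℚ-heavyCost-≤ : Σℚ heavyCost ≤ ℕtoℚ n * (ℕtoℚ 2 * Λ)
    Σℚ-heavyCost-≤ = begin
      Σℚ heavyCost                                    ≤⟨ Σℚ-mono-≤ heavyCost-≤ ⟩
      Σℚ (λ v → ℕtoℚ n * (ℕtoℚ 2 * (c v * w v)))      ≡⟨ Σℚ-*ˡ (ℕtoℚ n) (λ v → ℕtoℚ 2 * (c v * w v)) ⟩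
      ℕtoℚ n * Σℚ (λ v → ℕtoℚ 2 * (c v * w v))        ≡⟨ cong (ℕtoℚ n *_) (Σℚ-*ˡ (ℕtoℚ 2) (λ v → c v * w v)) ⟩
      ℕtoℚ n * (ℕtoℚ 2 * Λ)                           ∎
      where open QP.≤-Reasoning

    private
      multiplicity-ceiling : ∀ v → ∃[ k ] (ℕtoℚ N * heavyCost v ≤ Λ * ℕtoℚ (suc k) ×
                                           Λ * ℕtoℚ (suc k) ≤ ℕtoℚ N * heavyCost v + Λ)
      multiplicity-ceiling v = ceilingMultiple Λ≥0 (*-nonNeg (ℕtoℚ-nonNeg N) (heavyCost-nonNeg v)) (N ℕ.* (n ℕ.* 2)) (begin
        ℕtoℚ N * heavyCost v
          ≤⟨ *-monoˡ-≤ (ℕtoℚ-nonNeg N) (QP.≤-trans (term≤Σℚ heavyCost-nonNeg v) Σℚ-heavyCost-≤) ⟩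
        ℕtoℚ N * (ℕtoℚ n * (ℕtoℚ 2 * Λ))
          ≡⟨ solve 4 (λ a b t l → a :* (b :* (t :* l)) := l :* (a :* (b :* t))) refl (ℕtoℚ N) (ℕtoℚ n) (ℕtoℚ 2) Λ ⟩
        Λ * (ℕtoℚ N * (ℕtoℚ n * ℕtoℚ 2))
          ≡⟨ cong (Λ *_) (sym (trans (ℕtoℚ-* N (n ℕ.* 2)) (cong (ℕtoℚ N *_) (ℕtoℚ-* n 2)))) ⟩
        Λ * ℕtoℚ (N ℕ.* (n ℕ.* 2)) ∎)
        where open QP.≤-Reasoning

    open BlowUp E {Light = λ v → ¬ Heavy v} (λ v → ¬? (heavy? v)) (λ v → proj₁ (multiplicity-ceiling v)) public

    scaledCost≤ΛK : ∀ v → ℕtoℚ N * heavyCost v ≤ Λ * ℕtoℚ (K v)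
    scaledCost≤ΛK v = proj₁ (proj₂ (multiplicity-ceiling v))

    ΛK≤scaledCost+Λ : ∀ v → Λ * ℕtoℚ (K v) ≤ ℕtoℚ N * heavyCost v + Λ
    ΛK≤scaledCost+Λ v = proj₂ (proj₂ (multiplicity-ceiling v))

    total≤ : ℕtoℚ (total K) ≤ ℕtoℚ n * (ℕtoℚ 2 * ℕtoℚ N + 1ℚ)
    total≤ = *-cancelˡ-≤ Λ>0 (begin
      Λ * ℕtoℚ (total K)
        ≡⟨ cong (Λ *_) total-ℚ ⟩
      Λ * Σℚ (λ v → ℕtoℚ (K v))
        ≡⟨ sym (Σℚ-*ˡ Λ (λ v → ℕtoℚ (K v))) ⟩
      Σℚ (λ v → Λ * ℕtoℚ (K v))
        ≤⟨ Σℚ-mono-≤ ΛK≤scaledCost+Λ ⟩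
      Σℚ (λ v → ℕtoℚ N * heavyCost v + Λ)
        ≡⟨ Σℚ-+ (λ v → ℕtoℚ N * heavyCost v) (λ _ → Λ) ⟩
      Σℚ (λ v → ℕtoℚ N * heavyCost v) + Σℚ {n} (λ _ → Λ)
        ≡⟨ cong₂ _+_ (Σℚ-*ˡ (ℕtoℚ N) heavyCost) (Σℚ-const {n} Λ) ⟩
      ℕtoℚ N * Σℚ heavyCost + ℕtoℚ n * Λ
        ≤⟨ QP.+-monoˡ-≤ (ℕtoℚ n * Λ) (*-monoˡ-≤ (ℕtoℚ-nonNeg N) Σℚ-heavyCost-≤) ⟩
      ℕtoℚ N * (ℕtoℚ n * (ℕtoℚ 2 * Λ)) + ℕtoℚ n * Λ
        ≡⟨ solve 4 (λ a b t l → a :* (b :* (t :* l)) :+ b :* l := l :* (b :* (t :* a :+ con 1ℚ))) refl (ℕtoℚ N) (ℕtoℚ n) (ℕtoℚ 2) Λ ⟩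
      Λ * (ℕtoℚ n * (ℕtoℚ 2 * ℕtoℚ N + 1ℚ)) ∎)
      where open QP.≤-Reasoning

    N≤1+n : N ℕ.≤ suc n
    N≤1+n = ℕtoℚ-cancel-≤ (QP.≤-trans N≤W₂+1
      (subst (W₂ + 1ℚ ≤_) (trans (QP.+-comm (ℕtoℚ n) 1ℚ) (sym (ℕtoℚ-+ 1 n))) (QP.+-monoˡ-≤ 1ℚ W₂≤n)))

    total≤8n² : total K ℕ.≤ 8 ℕ.* (n ℕ.* n)
    total≤8n² = ℕP.≤-trans (ℕtoℚ-cancel-≤ (subst (ℕtoℚ (total K) ≤_) ℕtoℚ-bound total≤)) (n[2N+1]≤8n² 1≤n N≤1+n)
      where
      ℕtoℚ-bound : ℕtoℚ n * (ℕtoℚ 2 * ℕtoℚ N + 1ℚ) ≡ ℕtoℚ (n ℕ.* (2 ℕ.* N ℕ.+ 1))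
      ℕtoℚ-bound = sym (trans (ℕtoℚ-* n (2 ℕ.* N ℕ.+ 1)) (cong (ℕtoℚ n *_) (trans (ℕtoℚ-+ (2 ℕ.* N) 1) (cong (_+ 1ℚ) (ℕtoℚ-* 2 N)))))

    w′ : Fin (total K) → ℚ
    w′ = lift rounded

    w′-nonNeg : NonNeg w′
    w′-nonNeg a = rounded-nonNeg (original K a)

    W′≤2N+W₂ : Σℚ w′ ≤ ℕtoℚ 2 * ℕtoℚ N + W₂
    W′≤2N+W₂ = *-cancelˡ-≤ Λ>0 (begin
      Λ * Σℚ w′
        ≡⟨ cong (Λ *_) (Σℚ-lift rounded) ⟩
      Λ * Σℚ (λ v → ℕtoℚ (K v) * rounded v)
        ≡⟨ sym (Σℚ-*ˡ Λ (λ v → ℕtoℚ (K v) * rounded v)) ⟩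
      Σℚ (λ v → Λ * (ℕtoℚ (K v) * rounded v))
        ≤⟨ Σℚ-mono-≤ pointwise ⟩
      Σℚ (λ v → ℕtoℚ N * (ℕtoℚ 2 * (c v * w v)) + Λ * rounded v)
        ≡⟨ Σℚ-+ (λ v → ℕtoℚ N * (ℕtoℚ 2 * (c v * w v))) (λ v → Λ * rounded v) ⟩
      Σℚ (λ v → ℕtoℚ N * (ℕtoℚ 2 * (c v * w v))) + Σℚ (λ v → Λ * rounded v)
        ≡⟨ cong₂ _+_ (trans (Σℚ-*ˡ (ℕtoℚ N) (λ v → ℕtoℚ 2 * (c v * w v))) (cong (ℕtoℚ N *_) (Σℚ-*ˡ (ℕtoℚ 2) (λ v → c v * w v))))
                     (Σℚ-*ˡ Λ rounded) ⟩
      ℕtoℚ N * (ℕtoℚ 2 * Λ) + Λ * W₂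
        ≡⟨ solve 4 (λ a t l x → a :* (t :* l) :+ l :* x := l :* (t :* a :+ x)) refl (ℕtoℚ N) (ℕtoℚ 2) Λ W₂ ⟩
      Λ * (ℕtoℚ 2 * ℕtoℚ N + W₂) ∎)
      where
      open QP.≤-Reasoning
      pointwise : ∀ v → Λ * (ℕtoℚ (K v) * rounded v) ≤ ℕtoℚ N * (ℕtoℚ 2 * (c v * w v)) + Λ * rounded v
      pointwise v = begin
        Λ * (ℕtoℚ (K v) * rounded v)
          ≡⟨ sym (QP.*-assoc Λ (ℕtoℚ (K v)) (rounded v)) ⟩
        Λ * ℕtoℚ (K v) * rounded v
          ≤⟨ *-monoʳ-≤ (rounded-nonNeg v) (ΛK≤scaledCost+Λ v) ⟩
        (ℕtoℚ N * heavyCost v + Λ) * rounded v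
          ≡⟨ solve 4 (λ a h l r → (a :* h :+ l) :* r := a :* (h :* r) :+ l :* r) refl (ℕtoℚ N) (heavyCost v) Λ (rounded v) ⟩
        ℕtoℚ N * (heavyCost v * rounded v) + Λ * rounded v
          ≤⟨ QP.+-monoˡ-≤ (Λ * rounded v) (*-monoˡ-≤ (ℕtoℚ-nonNeg N) (heavyCost-rounded v)) ⟩
        ℕtoℚ N * (ℕtoℚ 2 * (c v * w v)) + Λ * rounded v ∎

    W′≤8W : Σℚ w′ ≤ ℕtoℚ 8 * W
    W′≤8W = begin
      Σℚ w′
        ≤⟨ W′≤2N+W₂ ⟩
      ℕtoℚ 2 * ℕtoℚ N + W₂
        ≤⟨ QP.+-mono-≤ (*-monoˡ-≤ (ℕtoℚ-nonNeg 2) (QP.≤-trans N≤W₂+1 (QP.+-mono-≤ W₂≤2W W≥1))) W₂≤2W ⟩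
      ℕtoℚ 2 * (ℕtoℚ 2 * W + W) + ℕtoℚ 2 * W
        ≡⟨ solve 1 (λ x → con (ℕtoℚ 2) :* (con (ℕtoℚ 2) :* x :+ x) :+ con (ℕtoℚ 2) :* x := con (ℕtoℚ 8) :* x) refl W ⟩
      ℕtoℚ 8 * W ∎
      where open QP.≤-Reasoning

    cutFromUnitCut : ∀ {M} → ∃[ X′ ] (IsCut E′ w′ X′ × costOf (λ _ → 1ℚ) X′ ≤ inner (λ _ → 1ℚ) w′ * ℕtoℚ M) →
      ∃[ X ] (IsCut E w X × costOf c X ≤ Λ * ℕtoℚ (8 ℕ.* M))
    cutFromUnitCut {M} (X′ , cut′ , X′-small) =
      liftedCut X′ , isCut-weaken rounded-vdist≥1 (liftedCut-isCut X′ rounded-light cut′) , *-cancelˡ-≤ 0<N (begin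
        ℕtoℚ N * costOf c (liftedCut X′)
          ≡⟨ sym (costOf-*ˡ (ℕtoℚ N) c (liftedCut X′)) ⟩
        costOf (λ v → ℕtoℚ N * c v) (liftedCut X′)
          ≤⟨ liftedCut-cost X′ (λ v → ℕtoℚ N * c v) Λ≥0 heavy⇒scaledCost≤ΛK ⟩
        Λ * costOf (λ _ → 1ℚ) X′
          ≤⟨ *-monoˡ-≤ Λ≥0 X′-small ⟩
        Λ * (inner (λ _ → 1ℚ) w′ * ℕtoℚ M)
          ≡⟨ cong (λ x → Λ * (x * ℕtoℚ M)) (Σℚ-cong (λ a → QP.*-identityˡ (w′ a))) ⟩
        Λ * (Σℚ w′ * ℕtoℚ M)
          ≤⟨ *-monoˡ-≤ Λ≥0 (*-monoʳ-≤ (ℕtoℚ-nonNeg M) (QP.≤-trans W′≤2N+W₂ (QP.+-monoʳ-≤ (ℕtoℚ 2 * ℕtoℚ N) W₂≤N))) ⟩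
        Λ * ((ℕtoℚ 2 * ℕtoℚ N + ℕtoℚ N) * ℕtoℚ M)
          ≡⟨ solve 3 (λ l a m → l :* ((con (ℕtoℚ 2) :* a :+ a) :* m) := a :* (l :* (con (ℕtoℚ 3) :* m))) refl Λ (ℕtoℚ N) (ℕtoℚ M) ⟩
        ℕtoℚ N * (Λ * (ℕtoℚ 3 * ℕtoℚ M))
          ≤⟨ *-monoˡ-≤ (ℕtoℚ-nonNeg N) (*-monoˡ-≤ Λ≥0 (*-monoʳ-≤ (ℕtoℚ-nonNeg M) (ℕtoℚ-mono-≤ {3} {8} (ℕP.+-monoʳ-≤ 3 ℕ.z≤n)))) ⟩
        ℕtoℚ N * (Λ * (ℕtoℚ 8 * ℕtoℚ M))
          ≡⟨ cong (λ x → ℕtoℚ N * (Λ * x)) (sym (ℕtoℚ-* 8 M)) ⟩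
        ℕtoℚ N * (Λ * ℕtoℚ (8 ℕ.* M)) ∎)
      where
      open QP.≤-Reasoning
      heavy⇒scaledCost≤ΛK : ∀ {v} → ¬ ¬ Heavy v → ℕtoℚ N * c v ≤ Λ * ℕtoℚ (K v)
      heavy⇒scaledCost≤ΛK {v} ¬light =
        subst (λ x → ℕtoℚ N * x ≤ Λ * ℕtoℚ (K v)) (heavyCost-heavy (decidable-stable (heavy? v) ¬light)) (scaledCost≤ΛK v)

  ¬¬-least : ∀ {P : ℕ → Set} {k} → P k → ¬ ¬ (∃[ u ] (P u × ∀ j → P j → u ℕ.≤ j))
  ¬¬-least {P} {k} Pk no-least = none-below (ℕP.n<1+n k) Pk
    where
    none-below : ∀ {j m} → j ℕ.< m → ¬ P j
    none-below {j} {suc m} (ℕ.s≤s j≤m) Pj with ℕP.m≤n⇒m<n∨m≡n j≤m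
    ... | inj₁ j<m  = none-below j<m Pj
    ... | inj₂ refl = no-least (j , Pj , λ i Pi → ℕP.≮⇒≥ (λ i<j → none-below i<j Pi))

  searchCut : ∀ {m} {P : (Fin m → Bool) → Set} → (∀ X → Dec (P X)) →
    (∀ {X Y} → (∀ v → X v ≡ Y v) → P X → P Y) → ¬ ¬ (∃ P) → ∃ P
  searchCut {P = P} P? resp = decidable-stable (Dec.map′
    (λ (xs , Pxs) → lookup xs , Pxs)
    (λ (X , PX) → tabulate X , resp (λ v → sym (lookup∘tabulate X v)) PX)
    (anySubset? (λ xs → P? (lookup xs))))

  isCut-resp : ∀ {n} {E : Graph n} {w : Fin n → ℚ} {X Y : Fin n → Bool} → (∀ v → X v ≡ Y v) → IsCut E w X → IsCut E w Y
  isCut-resp X≗Y cut s t vdist p =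
    let v , v∈ , v≢s , v≢t , Xv = cut s t vdist p in v , v∈ , v≢s , v≢t , subst T (X≗Y v) Xv

  costOf-resp : ∀ {n} (c : Fin n → ℚ) {X Y : Fin n → Bool} → (∀ v → X v ≡ Y v) → costOf c X ≡ costOf c Y
  costOf-resp c X≗Y = Σℚ-cong (λ v → cong (λ b → if b then c v else 0ℚ) (X≗Y v))

  -- The least u with GoodU exists only under double negation, which suffices because for a fixed
  -- instance the existence of a small cut is decidable.
  unitCut-withinBound : ∀ {m} (E : Graph m) {w : Fin m → ℚ} → NonNeg w → ∀ M →
    (∀ u → IsVufg m (Σℚ w) u → u ℕ.≤ M) →
    ∃[ X ] (IsCut E w X × costOf (λ _ → 1ℚ) X ≤ inner (λ _ → 1ℚ) w * ℕtoℚ M)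
  unitCut-withinBound {m} E {w} w≥0 M vufg≤M = searchCut
    (λ X → isCut? E w≥0 X ×-dec (costOf (λ _ → 1ℚ) X QP.≤? inner (λ _ → 1ℚ) w * ℕtoℚ M))
    (λ X≗Y (cut , small) → isCut-resp X≗Y cut , subst (_≤ inner (λ _ → 1ℚ) w * ℕtoℚ M) (costOf-resp (λ _ → 1ℚ) X≗Y) small)
    (¬¬-map (λ (u , vufg) → goodU-mono (vufg≤M u vufg) (proj₁ vufg) E w w≥0 refl) (¬¬-least {k = m} (goodU-size m (Σℚ w))))

  vfg-bound : ∀ {n W} M → (∀ n′ W′ u → n′ ℕ.≤ 8 ℕ.* (n ℕ.* n) → W′ ≤ ℕtoℚ 8 * W → IsVufg n′ W′ u → u ℕ.≤ M) →
    Good n W (8 ℕ.* M)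
  vfg-bound {n} M vufg≤M E c w c≥0 w≥0 refl = byCases (Σℚ w QP.<? 1ℚ) (0ℚ QP.<? inner c w)
    where
    Goal : Set
    Goal = ∃[ X ] (IsCut E w X × costOf c X ≤ inner c w * ℕtoℚ (8 ℕ.* M))
    byCases : Dec (Σℚ w < 1ℚ) → Dec (0ℚ < inner c w) → Goal
    byCases (yes W<1) _ = (λ _ → false) , ∅-isCut w≥0 W<1 ,
      subst (_≤ inner c w * ℕtoℚ (8 ℕ.* M)) (sym (costOf-∅ c)) (*-nonNeg (inner-nonNeg c≥0 w≥0) (ℕtoℚ-nonNeg (8 ℕ.* M)))
    byCases (no  _)   (no  Λ≯0) = threshold E w≥0 , threshold-isCut E w≥0 , (begin
      costOf c (threshold E w≥0)   ≤⟨ threshold-cost E w≥0 c c≥0 ⟩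
      inner c w * ℕtoℚ n           ≡⟨ cong (_* ℕtoℚ n) Λ≡0 ⟩
      0ℚ * ℕtoℚ n                  ≡⟨ trans (QP.*-zeroˡ (ℕtoℚ n)) (sym (QP.*-zeroˡ (ℕtoℚ (8 ℕ.* M)))) ⟩
      0ℚ * ℕtoℚ (8 ℕ.* M)          ≡⟨ cong (_* ℕtoℚ (8 ℕ.* M)) (sym Λ≡0) ⟩
      inner c w * ℕtoℚ (8 ℕ.* M)   ∎)
      where
      open QP.≤-Reasoning
      Λ≡0 : inner c w ≡ 0ℚ
      Λ≡0 = QP.≤-antisym (QP.≮⇒≥ Λ≯0) (inner-nonNeg c≥0 w≥0)
    byCases (no  W≮1) (yes Λ>0) =
      cutFromUnitCut {M} (unitCut-withinBound E′ w′-nonNeg M (λ u → vufg≤M (total K) (Σℚ w′) u total≤8n² W′≤8W))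
      where open Reduction E c≥0 w≥0 Λ>0 (QP.≮⇒≥ W≮1)


open import Data.Nat using (ℕ; _≤_; _*_)
open import Data.Rational using (ℚ)
open import Data.Product using (Σ; _,_)
import Data.Rational as Q
open CostReduction using (vfg-bound)

theorem7 : Σ ℕ λ C → ∀ (n : ℕ) (W : ℚ) (v : ℕ) → IsVfg n W v →
    ∀ (M : ℕ) →
    (∀ (n' : ℕ) (W' : ℚ) (u : ℕ) → n' ≤ C * (n * n) → W' Q.≤ ℕtoℚ C Q.* W →
      IsVufg n' W' u → u ≤ M) →
    v ≤ C * M
theorem7 = 8 , λ n W v (_ , least) M vufg≤M → least (8 * M) (vfg-bound M vufg≤M)
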